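{- Fix an integer $k\geq 0$ and suppose the following statement (P) holds for this $k$ and all integers $\ell,m\geq 1$: there exists a constant $f_1(k,\ell,m)$ such that for every undirected $k$-tree $G$, every collection $\vec{H}_1,\dots,\vec{H}_\ell$ of directed subgraphs of $G$ and every collection $M_1,\dots,M_m$ of subsets of $V(G)$, there is a coloring $\Psi\colon V(G)\to[f_1(k,\ell,m)]$ that is a proper coloring of $G$, restricts to a strong odd coloring on each $\vec{H}_i$, and is strong odd on each set $M_j$. Then there exists a constant $g_1(k)$ such that for every $k$-tree $G$ and every set $S$ of $(k+1)$-cliques of $G$, there is a coloring $\sigma\colon S\to[g_1(k)]$ such that (T'1) for every vertex $v$ of $G$, $\sigma$ is strong odd on the set of cliques in $S$ containing $v$; and (T'2) every color class of $\sigma$ has odd size.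
   Context: For an integer $k\geq 0$, a \emph{$k$-tree} is defined recursively: a clique on $k$ vertices is a $k$-tree, and a graph obtained from a $k$-tree by adding a new vertex adjacent to all vertices of an existing $k$-clique is a $k$-tree. A $(k+1)$-clique means a clique with exactly $k+1$ vertices. Directed graphs have no loops or multiple edges but may contain both $\vec{uv}$ and $\vec{vu}$; $N^+(\vec{H},v)=\{u:\vec{vu}\in E(\vec{H})\}$. An undirected graph $G$ is identified with the directed graph containing both orientations of each edge; a directed subgraph of $G$ is a subgraph of that directed graph. A coloring $\psi$ of a set $X$ is \emph{strong odd on a subset $M\subseteq X$} if for every color $c$, $|\psi^{ -1}(c)\cap M|$ is zero or odd. A vertex-coloring $\psi$ \emph{restricts to a strong odd coloring on a directed graph $\vec{H}$} if $\psi(u)\neq\psi(v)$ for every $\vec{uv}\in E(\vec{H})$ and $\psi$ is strong odd on $N^+(\vec{H},v)$ for every $v\in V(\vec{H})$. -}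

module Defs where

open import Data.Nat using (ℕ; zero; suc; _%_)
open import Data.Bool using (Bool; true; false; not)
open import Data.Fin using (Fin; zero; suc)
import Data.Fin as Fin
open import Data.Fin.Subset using (Subset; _∈_; _∩_; ∣_∣; ⊤)
open import Data.Fin.Subset.Properties using (_∈?_)
open import Data.Fin.Permutation using (Permutation′; _⟨$⟩ʳ_)
open import Data.Vec using (tabulate)
open import Data.Product using (Σ; _×_)
open import Data.Sum using (_⊎_)
open import Relation.Nullary using (¬_; does)
open import Relation.Binary.PropositionalEquality using (_≡_; _≢_)
open import Function.Definitions using (Injective)

Adj : ℕ → Set
Adj n = Fin n → Fin n → Bool

IsClique : ∀ {n} → Adj n → Subset n → Set
IsClique {n} adj C = ∀ (i j : Fin n) → i ∈ C → j ∈ C → i ≢ j → adj i j ≡ true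

complete : (n : ℕ) → Adj n
complete n i j = not (does (i Fin.≟ j))

extend : ∀ {n} → Adj n → Subset n → Adj (suc n)
extend adj C zero    zero    = false
extend adj C zero    (suc j) = does (j ∈? C)
extend adj C (suc i) zero    = does (i ∈? C)
extend adj C (suc i) (suc j) = adj i j

relabel : ∀ {n} → Permutation′ n → Adj n → Adj n
relabel π adj i j = adj (π ⟨$⟩ʳ i) (π ⟨$⟩ʳ j)

-- k-trees (closed under relabelling of vertices, i.e. up to isomorphism)
data KTree (k : ℕ) : (n : ℕ) → Adj n → Set where
  base    : KTree k k (complete k)
  add     : ∀ {n adj} → KTree k n adj → (C : Subset n) → ∣ C ∣ ≡ k →
            IsClique adj C → KTree k (suc n) (extend adj C)
  iso     : ∀ {n adj} (π : Permutation′ n) → KTree k n adj →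
            KTree k n (relabel π adj)

Odd : ℕ → Set
Odd s = s % 2 ≡ 1

colorClass : ∀ {N c} → (Fin N → Fin c) → Fin c → Subset N
colorClass ψ col = tabulate (λ x → does (ψ x Fin.≟ col))

StrongOdd : ∀ {N c} → (Fin N → Fin c) → Subset N → Set
StrongOdd {c = c} ψ M = ∀ (col : Fin c) →
  ∣ M ∩ colorClass ψ col ∣ ≡ 0 ⊎ Odd ∣ M ∩ colorClass ψ col ∣

record DiSub {n : ℕ} (adj : Adj n) : Set where
  field
    verts    : Subset n
    arcs     : Fin n → Fin n → Bool
    arc⊆adj  : ∀ u v → arcs u v ≡ true → adj u v ≡ true
    arc-tail : ∀ u v → arcs u v ≡ true → u ∈ verts
    arc-head : ∀ u v → arcs u v ≡ true → v ∈ verts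

outNbhd : ∀ {n} {adj : Adj n} → DiSub adj → Fin n → Subset n
outNbhd H v = tabulate (λ u → DiSub.arcs H v u)

RestrictsStrongOdd : ∀ {n c} {adj : Adj n} → (Fin n → Fin c) → DiSub adj → Set
RestrictsStrongOdd {n} ψ H =
  (∀ (u v : Fin n) → DiSub.arcs H u v ≡ true → ψ u ≢ ψ v) ×
  (∀ (v : Fin n) → v ∈ DiSub.verts H → StrongOdd ψ (outNbhd H v))

Proper : ∀ {n c} → Adj n → (Fin n → Fin c) → Set
Proper {n} adj ψ = ∀ (u v : Fin n) → adj u v ≡ true → ψ u ≢ ψ v

StatementP : ℕ → ℕ → ℕ → Set
StatementP k ℓ m = Σ ℕ λ f →
  ∀ (n : ℕ) (adj : Adj n) → KTree k n adj →
  (Hs : Fin ℓ → DiSub adj) (Ms : Fin m → Subset n) →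
  Σ (Fin n → Fin f) λ Ψ →
    Proper adj Ψ × (∀ i → RestrictsStrongOdd Ψ (Hs i)) × (∀ j → StrongOdd Ψ (Ms j))

-- a set S of cliques indexed without repetition by Fin N;
-- cliques of S containing v
containing : ∀ {n N} → (Fin N → Subset n) → Fin n → Subset N
containing S v = tabulate (λ i → does (v ∈? S i))

-- In a k-tree every (k+1)-clique D has a representative vertex x(D) ∈ D (the last
-- vertex of D to be added), and distinct cliques have distinct representatives.
-- Colour the representatives by applying (P) with ℓ = m = 1 to the digraph with
-- arcs v → x(D) for v ∈ D, v ≠ x(D), and to the set of all representatives; then
-- colour each clique D by the colour of x(D).  Since x is injective, (T'2) is the
-- strong oddness on the set of representatives.  For (T'1) at v, the cliques
-- through v correspond to N⁺(v), together with the clique represented by v itself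
-- if there is one; as v gets a colour different from all of N⁺(v), adding v keeps
-- every colour class zero or odd.
module Submission where

open import Defs
open import Data.Nat using (ℕ; zero; suc; _≤_; _≥_; s≤s; z≤n)
open import Data.Nat.Properties using (n≮n; ≤-trans; ≤-reflexive)
import Data.Nat.Properties as ℕ
open import Data.Bool using (Bool; true)
open import Data.Fin using (Fin; zero; suc; _≟_)
import Data.Fin.Properties as Fin
open import Data.Fin.Subset
  using (Subset; ∣_∣; ⊤; ⊥; ⁅_⁆; _∈_; _∉_; _∩_; _∪_; ∁; _⊆_; inside; outside)
open import Data.Fin.Subset.Properties
  using (_∈?_; ∉⊥; ∈⊤; ∣⊥∣≡0; ∣p∣≤n; x∈⁅x⁆; x∈⁅y⁆⇒x≡y; ∣⁅x⁆∣≡1; ⊆-antisym; drop-∷-⊆;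
         p⊆q⇒∣p∣≤∣q∣; x∈p∩q⁺; x∈p∩q⁻; p⊆p∪q; q⊆p∪q; x∈p∪q⁻; ∪-identityˡ;
         x∈∁p⇒x∉p; x∉p⇒x∈∁p)
open import Data.Fin.Permutation using (Permutation′; _⟨$⟩ʳ_; _⟨$⟩ˡ_; inverseˡ; inverseʳ)
open import Data.Vec using ([]; _∷_; here; there; tabulate; lookup)
open import Data.Vec.Properties using (lookup∘tabulate; []=⇒lookup; lookup⇒[]=; tabulate∘lookup)
open import Data.Product using (Σ; ∃; _×_; _,_; proj₁; proj₂)
open import Data.Sum using (_⊎_; inj₁; inj₂)
open import Function using (_∘_)
open import Function.Definitions using (Injective)
open import Relation.Nullary using (Dec; yes; no; does; contradiction)
open import Relation.Nullary.Decidable using (dec-true)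
open import Relation.Binary.PropositionalEquality
  using (_≡_; _≢_; refl; sym; trans; cong; subst; module ≡-Reasoning)

private
  variable
    n N : ℕ

does-true⇒ : ∀ {a} {A : Set a} (d : Dec A) → does d ≡ true → A
does-true⇒ (yes a) _  = a
does-true⇒ (no _)  ()

∈-tabulate⁺ : ∀ {f : Fin n → Bool} {i} → f i ≡ true → i ∈ tabulate f
∈-tabulate⁺ {f = f} {i} fi≡true = lookup⇒[]= i (tabulate f) (trans (lookup∘tabulate f i) fi≡true)

∈-tabulate⁻ : ∀ {f : Fin n → Bool} {i} → i ∈ tabulate f → f i ≡ true
∈-tabulate⁻ {f = f} {i} i∈ = trans (sym (lookup∘tabulate f i)) ([]=⇒lookup i∈)

∈-colorClass⁺ : ∀ {c} {ψ : Fin n → Fin c} {i col} → ψ i ≡ col → i ∈ colorClass ψ col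
∈-colorClass⁺ {ψ = ψ} {i} {col} ψi≡col = ∈-tabulate⁺ (dec-true (ψ i ≟ col) ψi≡col)

∈-colorClass⁻ : ∀ {c} {ψ : Fin n → Fin c} {i col} → i ∈ colorClass ψ col → ψ i ≡ col
∈-colorClass⁻ {ψ = ψ} {i} {col} i∈ = does-true⇒ (ψ i ≟ col) (∈-tabulate⁻ i∈)

∈-containing⁻ : ∀ {S : Fin N → Subset n} {v i} → i ∈ containing S v → v ∈ S i
∈-containing⁻ {S = S} {v} {i} i∈ = does-true⇒ (v ∈? S i) (∈-tabulate⁻ i∈)

x∉⁅y⁆⇒x≢y : ∀ {x y : Fin n} → x ∉ ⁅ y ⁆ → x ≢ y
x∉⁅y⁆⇒x≢y {y = y} x∉ refl = x∉ (x∈⁅x⁆ y)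

x∉p⇒∣⁅x⁆∪p∣≡1+∣p∣ : ∀ {x : Fin n} {p} → x ∉ p → ∣ ⁅ x ⁆ ∪ p ∣ ≡ suc ∣ p ∣
x∉p⇒∣⁅x⁆∪p∣≡1+∣p∣ {x = zero}  {outside ∷ p} _  = cong (suc ∘ ∣_∣) (∪-identityˡ p)
x∉p⇒∣⁅x⁆∪p∣≡1+∣p∣ {x = zero}  {inside  ∷ p} x∉ = contradiction here x∉
x∉p⇒∣⁅x⁆∪p∣≡1+∣p∣ {x = suc x} {outside ∷ p} x∉ = x∉p⇒∣⁅x⁆∪p∣≡1+∣p∣ (x∉ ∘ there)
x∉p⇒∣⁅x⁆∪p∣≡1+∣p∣ {x = suc x} {inside  ∷ p} x∉ = cong suc (x∉p⇒∣⁅x⁆∪p∣≡1+∣p∣ (x∉ ∘ there))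

p⊆q∧∣p∣≡∣q∣⇒p≡q : ∀ {p q : Subset n} → p ⊆ q → ∣ p ∣ ≡ ∣ q ∣ → p ≡ q
p⊆q∧∣p∣≡∣q∣⇒p≡q {p = []}          {[]}          _   _ = refl
p⊆q∧∣p∣≡∣q∣⇒p≡q {p = inside  ∷ p} {inside  ∷ q} p⊆q e =
  cong (inside ∷_) (p⊆q∧∣p∣≡∣q∣⇒p≡q (drop-∷-⊆ p⊆q) (ℕ.suc-injective e))
p⊆q∧∣p∣≡∣q∣⇒p≡q {p = inside  ∷ p} {outside ∷ q} p⊆q _ with p⊆q here
... | ()
p⊆q∧∣p∣≡∣q∣⇒p≡q {p = outside ∷ p} {inside  ∷ q} p⊆q e =
  contradiction (subst (_≤ ∣ q ∣) e (p⊆q⇒∣p∣≤∣q∣ (drop-∷-⊆ p⊆q))) (n≮n ∣ q ∣)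
p⊆q∧∣p∣≡∣q∣⇒p≡q {p = outside ∷ p} {outside ∷ q} p⊆q e =
  cong (outside ∷_) (p⊆q∧∣p∣≡∣q∣⇒p≡q (drop-∷-⊆ p⊆q) e)

ZeroOrOdd : ℕ → Set
ZeroOrOdd s = s ≡ 0 ⊎ Odd s

≤1⇒zeroOrOdd : ∀ {s} → s ≤ 1 → ZeroOrOdd s
≤1⇒zeroOrOdd z≤n       = inj₁ refl
≤1⇒zeroOrOdd (s≤s z≤n) = inj₂ refl

image : (Fin N → Fin n) → Subset N → Subset n
image x []            = ⊥
image x (outside ∷ p) = image (x ∘ suc) p
image x (inside  ∷ p) = ⁅ x zero ⁆ ∪ image (x ∘ suc) p

∈-image⁺ : ∀ (x : Fin N → Fin n) {p i} → i ∈ p → x i ∈ image x p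
∈-image⁺ x {inside  ∷ p} here        = p⊆p∪q _ (x∈⁅x⁆ (x zero))
∈-image⁺ x {inside  ∷ p} (there i∈p) = q⊆p∪q ⁅ x zero ⁆ _ (∈-image⁺ (x ∘ suc) i∈p)
∈-image⁺ x {outside ∷ p} (there i∈p) = ∈-image⁺ (x ∘ suc) i∈p

∈-image⁻ : ∀ (x : Fin N → Fin n) p {u} → u ∈ image x p → ∃ λ i → i ∈ p × x i ≡ u
∈-image⁻ x []            u∈ = contradiction u∈ ∉⊥
∈-image⁻ x (outside ∷ p) u∈ with ∈-image⁻ (x ∘ suc) p u∈
... | i , i∈p , xi≡u = suc i , there i∈p , xi≡u
∈-image⁻ x (inside  ∷ p) u∈ with x∈p∪q⁻ ⁅ x zero ⁆ (image (x ∘ suc) p) u∈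
... | inj₁ u∈⁅x₀⁆ = zero , here , sym (x∈⁅y⁆⇒x≡y (x zero) u∈⁅x₀⁆)
... | inj₂ u∈rest with ∈-image⁻ (x ∘ suc) p u∈rest
...   | i , i∈p , xi≡u = suc i , there i∈p , xi≡u

∣image∣≡∣p∣ : ∀ {x : Fin N → Fin n} → Injective _≡_ _≡_ x → ∀ p → ∣ image x p ∣ ≡ ∣ p ∣
∣image∣≡∣p∣ {n = n} inj [] = ∣⊥∣≡0 n
∣image∣≡∣p∣ inj (outside ∷ p) = ∣image∣≡∣p∣ (Fin.suc-injective ∘ inj) p
∣image∣≡∣p∣ {x = x} inj (inside ∷ p) =
  trans (x∉p⇒∣⁅x⁆∪p∣≡1+∣p∣ x₀∉) (cong suc (∣image∣≡∣p∣ (Fin.suc-injective ∘ inj) p))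
  where
  x₀∉ : x zero ∉ image (x ∘ suc) p
  x₀∉ x₀∈ with ∈-image⁻ (x ∘ suc) p x₀∈
  ... | _ , _ , xi≡x₀ with inj xi≡x₀
  ... | ()

image-injective : ∀ {x : Fin N → Fin n} → Injective _≡_ _≡_ x → Injective _≡_ _≡_ (image x)
image-injective {x = x} inj e = ⊆-antisym (⊆-from e) (⊆-from (sym e))
  where
  ⊆-from : ∀ {p q} → image x p ≡ image x q → p ⊆ q
  ⊆-from {p} {q} e {i} i∈p with ∈-image⁻ x q (subst (x i ∈_) e (∈-image⁺ x i∈p))
  ... | j , j∈q , xj≡xi = subst (_∈ q) (inj xj≡xi) j∈q

image-∩-colorClass : ∀ {c} (x : Fin N → Fin n) (ψ : Fin n → Fin c) p col →
                     image x (p ∩ colorClass (ψ ∘ x) col) ≡ image x p ∩ colorClass ψ col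
image-∩-colorClass x ψ p col = ⊆-antisym forward backward
  where
  forward : image x (p ∩ colorClass (ψ ∘ x) col) ⊆ image x p ∩ colorClass ψ col
  forward u∈ with ∈-image⁻ x (p ∩ colorClass (ψ ∘ x) col) u∈
  ... | i , i∈ , refl with x∈p∩q⁻ p _ i∈
  ...   | i∈p , i∈C = x∈p∩q⁺ (∈-image⁺ x i∈p , ∈-colorClass⁺ {ψ = ψ} (∈-colorClass⁻ {ψ = ψ ∘ x} i∈C))
  backward : image x p ∩ colorClass ψ col ⊆ image x (p ∩ colorClass (ψ ∘ x) col)
  backward u∈ with x∈p∩q⁻ (image x p) _ u∈
  ... | u∈im , u∈C with ∈-image⁻ x p u∈im
  ...   | i , i∈p , refl = ∈-image⁺ x (x∈p∩q⁺ (i∈p , ∈-colorClass⁺ {ψ = ψ ∘ x} (∈-colorClass⁻ {ψ = ψ} u∈C)))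

isClique-image : ∀ {adj : Adj n} (x : Fin N → Fin n) {D} →
                 IsClique (λ i j → adj (x i) (x j)) D → IsClique adj (image x D)
isClique-image x {D} clique u v u∈ v∈ u≢v with ∈-image⁻ x D u∈ | ∈-image⁻ x D v∈
... | i , i∈D , refl | j , j∈D , refl = clique i j i∈D j∈D (u≢v ∘ cong x)

strongOdd-image : ∀ {c} {x : Fin N → Fin n} {ψ : Fin n → Fin c} → Injective _≡_ _≡_ x →
                  ∀ p → StrongOdd ψ (image x p) → StrongOdd (ψ ∘ x) p
strongOdd-image {x = x} {ψ} inj p odd col = subst ZeroOrOdd same-size (odd col)
  where
  open ≡-Reasoning
  same-size : ∣ image x p ∩ colorClass ψ col ∣ ≡ ∣ p ∩ colorClass (ψ ∘ x) col ∣
  same-size = begin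
    ∣ image x p ∩ colorClass ψ col ∣             ≡⟨ cong ∣_∣ (sym (image-∩-colorClass x ψ p col)) ⟩
    ∣ image x (p ∩ colorClass (ψ ∘ x) col) ∣     ≡⟨ ∣image∣≡∣p∣ inj (p ∩ colorClass (ψ ∘ x) col) ⟩
    ∣ p ∩ colorClass (ψ ∘ x) col ∣               ∎

strongOdd-unpuncture : ∀ {c} {ψ : Fin n → Fin c} (A : Subset n) v →
                       (∀ {u} → u ∈ A → u ≢ v → ψ u ≢ ψ v) →
                       StrongOdd ψ (A ∩ ∁ ⁅ v ⁆) → StrongOdd ψ A
strongOdd-unpuncture {ψ = ψ} A v distinct odd col with ψ v ≟ col
... | yes refl = ≤1⇒zeroOrOdd (≤-trans (p⊆q⇒∣p∣≤∣q∣ only-v) (≤-reflexive (∣⁅x⁆∣≡1 v)))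
  where
  only-v : A ∩ colorClass ψ (ψ v) ⊆ ⁅ v ⁆
  only-v {u} u∈ with x∈p∩q⁻ A _ u∈ | u ≟ v
  ... | _         , _   | yes refl = x∈⁅x⁆ v
  ... | u∈A       , u∈C | no u≢v   = contradiction (∈-colorClass⁻ {ψ = ψ} u∈C) (distinct u∈A u≢v)
... | no ψv≢col = subst ZeroOrOdd (cong ∣_∣ same) (odd col)
  where
  same : (A ∩ ∁ ⁅ v ⁆) ∩ colorClass ψ col ≡ A ∩ colorClass ψ col
  same = ⊆-antisym forward backward
    where
    forward : (A ∩ ∁ ⁅ v ⁆) ∩ colorClass ψ col ⊆ A ∩ colorClass ψ col
    forward u∈ with x∈p∩q⁻ (A ∩ ∁ ⁅ v ⁆) _ u∈
    ... | u∈A∖v , u∈C = x∈p∩q⁺ (proj₁ (x∈p∩q⁻ A _ u∈A∖v) , u∈C)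
    backward : A ∩ colorClass ψ col ⊆ (A ∩ ∁ ⁅ v ⁆) ∩ colorClass ψ col
    backward {u} u∈ with x∈p∩q⁻ A _ u∈
    ... | u∈A , u∈C = x∈p∩q⁺ (x∈p∩q⁺ (u∈A , x∉p⇒x∈∁p u∉⁅v⁆) , u∈C)
      where
      u∉⁅v⁆ : u ∉ ⁅ v ⁆
      u∉⁅v⁆ u∈⁅v⁆ = ψv≢col (subst (λ w → ψ w ≡ col) (x∈⁅y⁆⇒x≡y v u∈⁅v⁆) (∈-colorClass⁻ {ψ = ψ} u∈C))

SizedClique : ℕ → Adj n → Subset n → Set
SizedClique s adj D = ∣ D ∣ ≡ s × IsClique adj D

record CliqueRepresentatives (s : ℕ) (adj : Adj n) : Set where
  field
    rep           : ∀ D → SizedClique s adj D → Fin n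
    rep∈          : ∀ D c → rep D c ∈ D
    rep-injective : ∀ {D D′} c c′ → rep D c ≡ rep D′ c′ → D ≡ D′

representatives-complete : ∀ k → CliqueRepresentatives (suc k) (complete k)
representatives-complete k = record
  { rep           = λ D c → absurd D c
  ; rep∈          = λ D c → absurd D c
  ; rep-injective = λ c _ _ → absurd _ c
  }
  where
  absurd : ∀ {A : Set} D → SizedClique (suc k) (complete k) D → A
  absurd D (size , _) = contradiction (subst (_≤ k) size (∣p∣≤n D)) (n≮n k)

isClique-extend-tail : ∀ {adj : Adj n} {C b D} → IsClique (extend adj C) (b ∷ D) → IsClique adj D
isClique-extend-tail clique i j i∈ j∈ i≢j =
  clique (suc i) (suc j) (there i∈) (there j∈) (i≢j ∘ Fin.suc-injective)

isClique-extend-⊆ : ∀ {adj : Adj n} {C D} → IsClique (extend adj C) (inside ∷ D) → D ⊆ C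
isClique-extend-⊆ {C = C} clique {i} i∈ = does-true⇒ (i ∈? C) (clique zero (suc i) here (there i∈) λ ())

-- The new vertex lies in exactly one (k+1)-clique, C with the vertex added, and represents it.
representatives-extend : ∀ {k} {adj : Adj n} C → ∣ C ∣ ≡ k →
                         CliqueRepresentatives (suc k) adj →
                         CliqueRepresentatives (suc k) (extend adj C)
representatives-extend {adj = adj} C ∣C∣≡k reps = record { rep = rep′ ; rep∈ = rep∈′ ; rep-injective = rep-injective′ }
  where
  open CliqueRepresentatives reps
  tail : ∀ {D} → SizedClique _ (extend adj C) (outside ∷ D) → SizedClique _ adj D
  tail (size , clique) = size , isClique-extend-tail clique
  equals-C : ∀ {D} → SizedClique _ (extend adj C) (inside ∷ D) → D ≡ C
  equals-C (size , clique) = p⊆q∧∣p∣≡∣q∣⇒p≡q (isClique-extend-⊆ clique) (trans (ℕ.suc-injective size) (sym ∣C∣≡k))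
  rep′ : ∀ D → SizedClique _ (extend adj C) D → Fin (suc _)
  rep′ (inside  ∷ D) c = zero
  rep′ (outside ∷ D) c = suc (rep D (tail c))
  rep∈′ : ∀ D c → rep′ D c ∈ D
  rep∈′ (inside  ∷ D) c = here
  rep∈′ (outside ∷ D) c = there (rep∈ D (tail c))
  rep-injective′ : ∀ {D D′} c c′ → rep′ D c ≡ rep′ D′ c′ → D ≡ D′
  rep-injective′ {inside  ∷ D} {inside  ∷ D′} c c′ _ = cong (inside ∷_) (trans (equals-C c) (sym (equals-C c′)))
  rep-injective′ {outside ∷ D} {outside ∷ D′} c c′ e =
    cong (outside ∷_) (rep-injective (tail c) (tail c′) (Fin.suc-injective e))
  rep-injective′ {inside  ∷ D} {outside ∷ D′} c c′ ()
  rep-injective′ {outside ∷ D} {inside  ∷ D′} c c′ ()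

permutation-injective : (π : Permutation′ n) → Injective _≡_ _≡_ (π ⟨$⟩ʳ_)
permutation-injective π {i} {j} e = trans (sym (inverseˡ π)) (trans (cong (π ⟨$⟩ˡ_) e) (inverseˡ π))

inverse-injective : (π : Permutation′ n) → Injective _≡_ _≡_ (π ⟨$⟩ˡ_)
inverse-injective π {i} {j} e = trans (sym (inverseʳ π)) (trans (cong (π ⟨$⟩ʳ_) e) (inverseʳ π))

representatives-relabel : ∀ {s} {adj : Adj n} (π : Permutation′ n) →
                          CliqueRepresentatives s adj → CliqueRepresentatives s (relabel π adj)
representatives-relabel {adj = adj} π reps = record { rep = rep′ ; rep∈ = rep∈′ ; rep-injective = rep-injective′ }
  where
  open CliqueRepresentatives reps
  π[_] : Subset _ → Subset _
  π[_] = image (π ⟨$⟩ʳ_)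
  moved : ∀ {D} → SizedClique _ (relabel π adj) D → SizedClique _ adj π[ D ]
  moved {D} (size , clique) = trans (∣image∣≡∣p∣ (permutation-injective π) D) size , isClique-image (π ⟨$⟩ʳ_) clique
  rep′ : ∀ D → SizedClique _ (relabel π adj) D → Fin _
  rep′ D c = π ⟨$⟩ˡ rep π[ D ] (moved c)
  rep∈′ : ∀ D c → rep′ D c ∈ D
  rep∈′ D c with ∈-image⁻ (π ⟨$⟩ʳ_) D (rep∈ π[ D ] (moved c))
  ... | i , i∈D , πi≡r = subst (_∈ D) (trans (sym (inverseˡ π)) (cong (π ⟨$⟩ˡ_) πi≡r)) i∈D
  rep-injective′ : ∀ {D D′} c c′ → rep′ D c ≡ rep′ D′ c′ → D ≡ D′
  rep-injective′ c c′ e =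
    image-injective (permutation-injective π) (rep-injective (moved c) (moved c′) (inverse-injective π e))

kTree-representatives : ∀ {k adj} → KTree k n adj → CliqueRepresentatives (suc k) adj
kTree-representatives {k = k} base = representatives-complete k
kTree-representatives (add t C ∣C∣≡k _) = representatives-extend C ∣C∣≡k (kTree-representatives t)
kTree-representatives (iso π t)         = representatives-relabel π (kTree-representatives t)

module _ {adj : Adj n} (S : Fin N → Subset n) (x : Fin N → Fin n)
         (x-injective : Injective _≡_ _≡_ x) (x∈S : ∀ i → x i ∈ S i)
         (S-clique : ∀ i → IsClique adj (S i)) where

  repsThrough : Fin n → Subset n
  repsThrough v = image x (containing S v)

  outRepsThrough : Fin n → Subset n
  outRepsThrough v = repsThrough v ∩ ∁ ⁅ v ⁆

  repsThrough-adj : ∀ {v u} → u ∈ repsThrough v → u ≢ v → adj v u ≡ true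
  repsThrough-adj {v} u∈ u≢v with ∈-image⁻ x (containing S v) u∈
  ... | i , i∈ , refl = S-clique i v (x i) (∈-containing⁻ {S = S} i∈) (x∈S i) (u≢v ∘ sym)

  representativeDigraph : DiSub adj
  representativeDigraph = record
    { verts    = ⊤
    ; arcs     = λ v → lookup (outRepsThrough v)
    ; arc⊆adj  = arc⊆adj
    ; arc-tail = λ _ _ _ → ∈⊤
    ; arc-head = λ _ _ _ → ∈⊤
    }
    where
    arc⊆adj : ∀ v u → lookup (outRepsThrough v) u ≡ true → adj v u ≡ true
    arc⊆adj v u arc with x∈p∩q⁻ (repsThrough v) _ (lookup⇒[]= u _ arc)
    ... | u∈ , u∉⁅v⁆ = repsThrough-adj u∈ (x∉⁅y⁆⇒x≢y (x∈∁p⇒x∉p u∉⁅v⁆))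

  strongOdd-representatives : ∀ {c} (ψ : Fin n → Fin c) →
    RestrictsStrongOdd ψ representativeDigraph → StrongOdd ψ (image x ⊤) →
    (∀ v → StrongOdd (ψ ∘ x) (containing S v)) × StrongOdd (ψ ∘ x) ⊤
  strongOdd-representatives ψ (arcs-distinct , out-odd) all-odd =
    (λ v → strongOdd-image {ψ = ψ} x-injective (containing S v)
             (strongOdd-unpuncture (repsThrough v) v (distinct v) (out-odd′ v))) ,
    strongOdd-image {ψ = ψ} x-injective ⊤ all-odd
    where
    out-odd′ : ∀ v → StrongOdd ψ (outRepsThrough v)
    out-odd′ v = subst (StrongOdd ψ) (tabulate∘lookup (outRepsThrough v)) (out-odd v ∈⊤)
    distinct : ∀ v {u} → u ∈ repsThrough v → u ≢ v → ψ u ≢ ψ v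
    distinct v {u} u∈ u≢v = arcs-distinct v u arc ∘ sym
      where
      arc : lookup (outRepsThrough v) u ≡ true
      arc = []=⇒lookup (x∈p∩q⁺ (u∈ , x∉p⇒x∈∁p (u≢v ∘ x∈⁅y⁆⇒x≡y v)))

lemma11 : (k : ℕ) →
    (∀ (ℓ m : ℕ) → ℓ ≥ 1 → m ≥ 1 → StatementP k ℓ m) →
    Σ ℕ λ g →
      ∀ (n : ℕ) (adj : Adj n) → KTree k n adj →
      (N : ℕ) (S : Fin N → Subset n) → Injective _≡_ _≡_ S →
      (∀ i → ∣ S i ∣ ≡ suc k × IsClique adj (S i)) →
      Σ (Fin N → Fin g) λ σ →
        (∀ (v : Fin n) → StrongOdd σ (containing S v)) × StrongOdd σ ⊤
lemma11 k P with P 1 1 (s≤s z≤n) (s≤s z≤n)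
... | f , colour = f , λ n adj t N S S-injective S-sized →
  let open CliqueRepresentatives (kTree-representatives t)
      x : Fin N → Fin n
      x i = rep (S i) (S-sized i)
      x-injective : Injective _≡_ _≡_ x
      x-injective e = S-injective (rep-injective (S-sized _) (S-sized _) e)
      x∈S : ∀ i → x i ∈ S i
      x∈S i = rep∈ (S i) (S-sized i)
      H = representativeDigraph S x x-injective x∈S (proj₂ ∘ S-sized)
      ψ , _ , restricts , odd = colour n adj t (λ _ → H) (λ _ → image x ⊤)
  in ψ ∘ x , strongOdd-representatives S x x-injective x∈S (proj₂ ∘ S-sized) ψ (restricts zero) (odd zero)
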